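{- For all integers $d,\ell,n\ge 2$ with $n$ even, the graph $\mathcal{D}_{\ell}(\mathbb{Q}_n^d)$ has diameter at least \[\frac{n^{d-1}(n^2-1)}{6\ell^2}.\]
   Context: $\mathbb{Q}^d_n$ is the graph with vertex set $\{1,\dots,n\}^d$, where two vertices are adjacent if they differ in exactly one coordinate, by exactly $1$. A dimer configuration on a graph $G$ is a perfect matching; its edges are dimers. An alternating cycle is a cycle of even length in which every second edge is a dimer; switching it exchanges dimer and non-dimer edges along the cycle. For $\ell\ge 2$, $\mathcal{D}_\ell(G)$ is the graph on dimer configurations of $G$ in which two configurations are adjacent if one is obtained from the other by switching an alternating cycle of length at most $2\ell$. -}

module Defs where

open import Data.Nat using (ℕ; zero; suc; _+_; _*_; _∸_; _^_; _≤_)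
open import Data.Nat.DivMod using (_mod_)
open import Data.Fin using (Fin; toℕ)
open import Data.Vec using (Vec; []; _∷_)
open import Data.Product using (Σ; _×_; ∃)
open import Data.Sum using (_⊎_)
open import Relation.Binary.PropositionalEquality using (_≡_; _≢_)

-- Vertices of Q^d_n : {1..n}^d, coordinates encoded in Fin n = {0..n-1}.
Vertex : ℕ → ℕ → Set
Vertex d n = Vec (Fin n) d

Step : ∀ {n} → Fin n → Fin n → Set
Step x y = (toℕ y ≡ suc (toℕ x)) ⊎ (toℕ x ≡ suc (toℕ y))

data Adj {n : ℕ} : ∀ {d} → Vertex d n → Vertex d n → Set where
  here  : ∀ {d x y} {xs : Vertex d n} → Step x y → Adj (x ∷ xs) (y ∷ xs)
  there : ∀ {d x} {xs ys : Vertex d n} → Adj xs ys → Adj (x ∷ xs) (x ∷ ys)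

-- A dimer configuration (perfect matching) of Q^d_n, given by the partner map:
-- each vertex is matched to an adjacent vertex, and the matching relation is symmetric.
record Dimer (d n : ℕ) : Set where
  field
    partner : Vertex d n → Vertex d n
    adj     : ∀ v → Adj v (partner v)
    invol   : ∀ v → partner (partner v) ≡ v
open Dimer public

_≈D_ : ∀ {d n} → Dimer d n → Dimer d n → Set
_≈D_ {d} {n} M N = ∀ (v : Vertex d n) → partner M v ≡ partner N v

next : ∀ {m} → Fin (suc m) → Fin (suc m)
next {m} i = suc (toℕ i) mod (suc m)

-- M' is obtained from M by switching an alternating cycle of length 2k
-- (k ≥ 2), the cycle being a 0 , b 0 , a 1 , b 1 , … , a (k-1) , b (k-1) , (back to a 0),
-- with dimers {a i , b i} in M, and non-dimer edges {b i , a (next i)}.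
record SwitchCycle {d n : ℕ} (k : ℕ) (M M' : Dimer d n) : Set where
  field
    m      : ℕ
    k≡     : k ≡ suc m
    a b    : Fin (suc m) → Vertex d n
    a-inj  : ∀ i j → a i ≡ a j → i ≡ j
    b-inj  : ∀ i j → b i ≡ b j → i ≡ j
    a≢b    : ∀ i j → a i ≢ b j
    edge   : ∀ i → Adj (b i) (a (next i))
    dimer  : ∀ i → partner M (a i) ≡ b i
    sw₁    : ∀ i → partner M' (b i) ≡ a (next i)
    sw₂    : ∀ i → partner M' (a (next i)) ≡ b i
    same   : ∀ v → (∀ i → v ≢ a i) → (∀ i → v ≢ b i) → partner M' v ≡ partner M v

-- Adjacency in 𝒟_ℓ(Q^d_n): switching an alternating cycle of length 2k ≤ 2ℓ.
-- (A cycle of even length has length ≥ 4, i.e. k ≥ 2.)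
Move : ∀ {d n} → ℕ → Dimer d n → Dimer d n → Set
Move ℓ M M' = ∃ λ k → 2 ≤ k × k ≤ ℓ × SwitchCycle k M M'

Walk : ∀ {d n} → ℕ → ℕ → Dimer d n → Dimer d n → Set
Walk ℓ zero    M N = M ≈D N
Walk ℓ (suc t) M N = Σ _ λ M' → Move ℓ M M' × Walk ℓ t M' N

Even : ℕ → Set
Even n = ∃ λ h → n ≡ h + h

-- The potential Φ P = Σ_v σ(v) y(v) (x(P v) − x(v)), with σ the checkerboard sign and x, y the
-- first two coordinates, is a discrete signed area. Switching an alternating cycle of length 2k
-- changes Φ by a sum of terms ±(y − c) Δx around the cycle; since the cycle is a closed walk of 2k
-- unit steps, its heights y stay within min(i, 2k − i) of the starting height c, so |ΔΦ| ≤ 2k².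
-- Hence a walk of length t in 𝒟_ℓ changes Φ by at most 2ℓ²t. Tiling every two-dimensional slice by
-- concentric square rings, once with the corners of each ring paired horizontally and once
-- vertically, gives two configurations whose potentials differ by n^(d−2) · n(n² − 1)/3, which
-- forces t ≥ n^(d−1)(n² − 1)/(6ℓ²).

{-# OPTIONS --safe #-}
module Submission where

open import Defs
open import Data.Nat using (ℕ; zero; suc; _+_; _*_; _∸_; _^_; _≤_; _<_; z≤n; s≤s; _⊓_; _≤?_)
import Data.Nat.Properties as ℕP
open import Data.Nat.DivMod using (_mod_; _%_)
import Data.Nat.DivMod as DivModP
open import Data.Nat.Tactic.RingSolver using () renaming (solve-∀ to ℕ-solve)
open import Data.Integer using (ℤ; +_; -_; ∣_∣) renaming (_+_ to _+ᶻ_; _*_ to _*ᶻ_; _-_ to _-ᶻ_)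
import Data.Integer.Properties as ℤP
open import Data.Integer.Tactic.RingSolver using () renaming (solve-∀ to ℤ-solve)
open import Data.Fin using (Fin; toℕ; fromℕ<) renaming (zero to fzero; suc to fsuc)
import Data.Fin.Properties as FinP
open import Data.Vec using ([]; _∷_; _++_)
import Data.Vec.Properties as VecP
open import Data.Bool using (Bool; true; false; not; _xor_; if_then_else_)
import Data.Bool.Properties as BoolP
open import Data.Product using (_×_; _,_; proj₁; proj₂; ∃₂; swap)
open import Data.Sum using (_⊎_; inj₁; inj₂) renaming (swap to ⊎-swap)
open import Data.Empty using (⊥-elim)
open import Function using (_∘_)
open import Relation.Nullary using (¬_; Dec; yes; no)
open import Relation.Binary.PropositionalEquality
import Algebra.Properties.Semiring.Sum as SemiringSum

module ℤ∑ = SemiringSum ℤP.+-*-semiring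
module ℕ∑ = SemiringSum ℕP.+-*-semiring

∑ᶻ : ℕ → (ℕ → ℤ) → ℤ
∑ᶻ k f = ℤ∑.sum {k} (f ∘ toℕ)

∑ⁿ : ℕ → (ℕ → ℕ) → ℕ
∑ⁿ k f = ℕ∑.sum {k} (f ∘ toℕ)

∑ᶻ-cong : ∀ k {f g : ℕ → ℤ} → (∀ i → i < k → f i ≡ g i) → ∑ᶻ k f ≡ ∑ᶻ k g
∑ᶻ-cong k f≗g = ℤ∑.sum-cong-≗ (λ i → f≗g (toℕ i) (FinP.toℕ<n i))

∑ᶻ-distrib-+ : ∀ k (f g : ℕ → ℤ) → ∑ᶻ k (λ i → f i +ᶻ g i) ≡ ∑ᶻ k f +ᶻ ∑ᶻ k g
∑ᶻ-distrib-+ k f g = ℤ∑.∑-distrib-+ {k} (f ∘ toℕ) (g ∘ toℕ)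

∑ᶻ-zero : ∀ k → ∑ᶻ k (λ _ → + 0) ≡ + 0
∑ᶻ-zero = ℤ∑.sum-replicate-zero

∑ᶻ-const : ∀ k c → ∑ᶻ k (λ _ → c) ≡ + k *ᶻ c
∑ᶻ-const zero    c = sym (ℤP.*-zeroˡ c)
∑ᶻ-const (suc k) c = begin
  c +ᶻ ∑ᶻ k (λ _ → c)  ≡⟨ cong (c +ᶻ_) (∑ᶻ-const k c) ⟩
  c +ᶻ + k *ᶻ c        ≡⟨ factor c (+ k) ⟩
  + suc k *ᶻ c         ∎
  where
  open ≡-Reasoning
  factor : ∀ c k → c +ᶻ k *ᶻ c ≡ (+ 1 +ᶻ k) *ᶻ c
  factor = ℤ-solve

∑ᶻ-split : ∀ p q (f : ℕ → ℤ) → ∑ᶻ (p + q) f ≡ ∑ᶻ p f +ᶻ ∑ᶻ q (λ i → f (p + i))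
∑ᶻ-split zero    q f = sym (ℤP.+-identityˡ _)
∑ᶻ-split (suc p) q f = trans (cong (f 0 +ᶻ_) (∑ᶻ-split p q (f ∘ suc))) (sym (ℤP.+-assoc (f 0) _ _))

∑ᶻ-snoc : ∀ k (f : ℕ → ℤ) → ∑ᶻ (suc k) f ≡ ∑ᶻ k f +ᶻ f k
∑ᶻ-snoc k f = begin
  ∑ᶻ (suc k) f                 ≡⟨ cong (λ m → ∑ᶻ m f) (ℕP.+-comm 1 k) ⟩
  ∑ᶻ (k + 1) f                 ≡⟨ ∑ᶻ-split k 1 f ⟩
  ∑ᶻ k f +ᶻ (f (k + 0) +ᶻ + 0) ≡⟨ cong (∑ᶻ k f +ᶻ_) (trans (ℤP.+-identityʳ _) (cong f (ℕP.+-identityʳ k))) ⟩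
  ∑ᶻ k f +ᶻ f k                ∎
  where open ≡-Reasoning

∑ᶻ-reverse : ∀ k (f : ℕ → ℤ) → ∑ᶻ k f ≡ ∑ᶻ k (λ i → f (k ∸ suc i))
∑ᶻ-reverse zero    f = refl
∑ᶻ-reverse (suc k) f = begin
  ∑ᶻ (suc k) f                    ≡⟨ ∑ᶻ-snoc k f ⟩
  ∑ᶻ k f +ᶻ f k                   ≡⟨ ℤP.+-comm (∑ᶻ k f) (f k) ⟩
  f k +ᶻ ∑ᶻ k f                   ≡⟨ cong (f k +ᶻ_) (∑ᶻ-reverse k f) ⟩
  f k +ᶻ ∑ᶻ k (λ i → f (k ∸ suc i)) ∎
  where open ≡-Reasoning

∑ᶻ-telescope : ∀ k (g : ℕ → ℤ) → ∑ᶻ k (λ j → g j -ᶻ g (suc j)) ≡ g 0 -ᶻ g k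
∑ᶻ-telescope zero    g = sym (ℤP.+-inverseʳ (g 0))
∑ᶻ-telescope (suc k) g =
  trans (cong (g 0 -ᶻ g 1 +ᶻ_) (∑ᶻ-telescope k (g ∘ suc))) (cancel (g 0) (g 1) (g (suc k)))
  where
  cancel : ∀ a b c → a -ᶻ b +ᶻ (b -ᶻ c) ≡ a -ᶻ c
  cancel = ℤ-solve

∑ᶻ-rotate : ∀ k (f : ℕ → ℤ) → f k ≡ f 0 → ∑ᶻ k (λ j → f (suc j)) ≡ ∑ᶻ k f
∑ᶻ-rotate k f periodic = sym (begin
  ∑ᶻ k f                                                    ≡⟨ ∑ᶻ-cong k (λ j _ → split (f j) (f (suc j))) ⟩
  ∑ᶻ k (λ j → (f j -ᶻ f (suc j)) +ᶻ f (suc j))              ≡⟨ ∑ᶻ-distrib-+ k (λ j → f j -ᶻ f (suc j)) (f ∘ suc) ⟩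
  ∑ᶻ k (λ j → f j -ᶻ f (suc j)) +ᶻ ∑ᶻ k (f ∘ suc)           ≡⟨ cong (_+ᶻ ∑ᶻ k (f ∘ suc)) (∑ᶻ-telescope k f) ⟩
  f 0 -ᶻ f k +ᶻ ∑ᶻ k (f ∘ suc)                              ≡⟨ cong (λ x → f 0 -ᶻ x +ᶻ ∑ᶻ k (f ∘ suc)) periodic ⟩
  f 0 -ᶻ f 0 +ᶻ ∑ᶻ k (f ∘ suc)                              ≡⟨ vanish (f 0) _ ⟩
  ∑ᶻ k (f ∘ suc)                                            ∎)
  where
  open ≡-Reasoning
  split : ∀ x y → x ≡ (x -ᶻ y) +ᶻ y
  split = ℤ-solve
  vanish : ∀ x y → x -ᶻ x +ᶻ y ≡ y
  vanish = ℤ-solve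

∑ⁿ-mono-≤ : ∀ k {f g : ℕ → ℕ} → (∀ i → i < k → f i ≤ g i) → ∑ⁿ k f ≤ ∑ⁿ k g
∑ⁿ-mono-≤ zero    f≤g = z≤n
∑ⁿ-mono-≤ (suc k) f≤g = ℕP.+-mono-≤ (f≤g 0 (s≤s z≤n)) (∑ⁿ-mono-≤ k (λ i i<k → f≤g (suc i) (s≤s i<k)))

∑ⁿ-split : ∀ p q (f : ℕ → ℕ) → ∑ⁿ (p + q) f ≡ ∑ⁿ p f + ∑ⁿ q (λ i → f (p + i))
∑ⁿ-split zero    q f = refl
∑ⁿ-split (suc p) q f = trans (cong (_+_ (f 0)) (∑ⁿ-split p q (f ∘ suc))) (sym (ℕP.+-assoc (f 0) _ _))

∑ⁿ-snoc : ∀ k (f : ℕ → ℕ) → ∑ⁿ (suc k) f ≡ ∑ⁿ k f + f k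
∑ⁿ-snoc k f = begin
  ∑ⁿ (suc k) f             ≡⟨ cong (λ m → ∑ⁿ m f) (ℕP.+-comm 1 k) ⟩
  ∑ⁿ (k + 1) f             ≡⟨ ∑ⁿ-split k 1 f ⟩
  ∑ⁿ k f + (f (k + 0) + 0) ≡⟨ cong (_+_ (∑ⁿ k f)) (trans (ℕP.+-identityʳ _) (cong f (ℕP.+-identityʳ k))) ⟩
  ∑ⁿ k f + f k             ∎
  where open ≡-Reasoning

∑ⁿ-const : ∀ k c → ∑ⁿ k (λ _ → c) ≡ k * c
∑ⁿ-const zero    c = refl
∑ⁿ-const (suc k) c = cong (_+_ c) (∑ⁿ-const k c)

∑ⁿ-pairs : ∀ k (f : ℕ → ℕ) → ∑ⁿ (k + k) f ≡ ∑ⁿ k (λ j → f (j + j) + f (suc (j + j)))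
∑ⁿ-pairs zero    f = refl
∑ⁿ-pairs (suc k) f = begin
  f 0 + ∑ⁿ (k + suc k) (f ∘ suc)
    ≡⟨ cong (λ m → f 0 + ∑ⁿ m (f ∘ suc)) (ℕP.+-suc k k) ⟩
  f 0 + (f 1 + ∑ⁿ (k + k) (f ∘ suc ∘ suc))
    ≡⟨ cong (λ s → f 0 + (f 1 + s)) (∑ⁿ-pairs k (f ∘ suc ∘ suc)) ⟩
  f 0 + (f 1 + ∑ⁿ k (λ j → f (2 + (j + j)) + f (3 + (j + j))))
    ≡⟨ sym (ℕP.+-assoc (f 0) (f 1) _) ⟩
  f 0 + f 1 + ∑ⁿ k (λ j → f (2 + (j + j)) + f (3 + (j + j)))
    ≡⟨ cong (_+_ (f 0 + f 1)) (ℕ∑.sum-cong-≗ {k} λ j → cong (λ m → f (suc m) + f (2 + m)) (sym (ℕP.+-suc (toℕ j) (toℕ j)))) ⟩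
  f 0 + f 1 + ∑ⁿ k (λ j → f (suc j + suc j) + f (suc (suc j + suc j))) ∎
  where open ≡-Reasoning

∑ᶻ-pos : ∀ k (f : ℕ → ℕ) → ∑ᶻ k (λ i → + f i) ≡ + ∑ⁿ k f
∑ᶻ-pos zero    f = refl
∑ᶻ-pos (suc k) f = cong (+ f 0 +ᶻ_) (∑ᶻ-pos k (f ∘ suc))

∣∑ᶻ∣≤∑ⁿ∣∣ : ∀ k (f : ℕ → ℤ) → ∣ ∑ᶻ k f ∣ ≤ ∑ⁿ k (λ j → ∣ f j ∣)
∣∑ᶻ∣≤∑ⁿ∣∣ zero    f = z≤n
∣∑ᶻ∣≤∑ⁿ∣∣ (suc k) f = ℕP.≤-trans (ℤP.∣i+j∣≤∣i∣+∣j∣ (f 0) _) (ℕP.+-monoʳ-≤ ∣ f 0 ∣ (∣∑ᶻ∣≤∑ⁿ∣∣ k (f ∘ suc)))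

when : ∀ {P : Set} → Dec P → ℤ → ℤ
when (yes _) c = c
when (no _)  _ = + 0

when-yes : ∀ {P : Set} (P? : Dec P) c → P → when P? c ≡ c
when-yes (yes _) c _ = refl
when-yes (no ¬p) c p = ⊥-elim (¬p p)

when-no : ∀ {P : Set} (P? : Dec P) c → ¬ P → when P? c ≡ + 0
when-no (yes p) c ¬p = ⊥-elim (¬p p)
when-no (no _)  c _  = refl

∑-when-none : ∀ k {P : Fin k → Set} (P? : ∀ i → Dec (P i)) (c : Fin k → ℤ) →
  (∀ i → ¬ P i) → ℤ∑.sum (λ i → when (P? i) (c i)) ≡ + 0
∑-when-none k P? c ¬P = trans (ℤ∑.sum-cong-≗ {k} (λ i → when-no (P? i) (c i) (¬P i))) (∑ᶻ-zero k)

∑-when-unique : ∀ k {P : Fin k → Set} (P? : ∀ i → Dec (P i)) (c : Fin k → ℤ) (j : Fin k) →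
  P j → (∀ i → P i → i ≡ j) → ℤ∑.sum (λ i → when (P? i) (c i)) ≡ c j
∑-when-unique (suc k) P? c fzero Pj unique = begin
  when (P? fzero) (c fzero) +ᶻ ℤ∑.sum (λ i → when (P? (fsuc i)) (c (fsuc i)))
    ≡⟨ cong₂ _+ᶻ_ (when-yes (P? fzero) (c fzero) Pj)
                  (∑-when-none k (P? ∘ fsuc) (c ∘ fsuc) (λ i Pi → FinP.0≢1+n (sym (unique (fsuc i) Pi)))) ⟩
  c fzero +ᶻ + 0
    ≡⟨ ℤP.+-identityʳ (c fzero) ⟩
  c fzero ∎
  where open ≡-Reasoning
∑-when-unique (suc k) P? c (fsuc j) Pj unique = begin
  when (P? fzero) (c fzero) +ᶻ ℤ∑.sum (λ i → when (P? (fsuc i)) (c (fsuc i)))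
    ≡⟨ cong₂ _+ᶻ_ (when-no (P? fzero) (c fzero) (λ P0 → FinP.0≢1+n (unique fzero P0)))
                  (∑-when-unique k (P? ∘ fsuc) (c ∘ fsuc) j Pj (λ i Pi → FinP.suc-injective (unique (fsuc i) Pi))) ⟩
  + 0 +ᶻ c (fsuc j)
    ≡⟨ ℤP.+-identityˡ (c (fsuc j)) ⟩
  c (fsuc j) ∎
  where open ≡-Reasoning

-- Sums over the vertices of the cube

_≟ᵛ_ : ∀ {d n} (v w : Vertex d n) → Dec (v ≡ w)
_≟ᵛ_ = VecP.≡-dec FinP._≟_

∑ᵛ : ∀ {n} d → (Vertex d n → ℤ) → ℤ
∑ᵛ zero    f = f []
∑ᵛ (suc d) f = ℤ∑.sum (λ i → ∑ᵛ d (λ w → f (i ∷ w)))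

∑ᵛ-cong : ∀ {n} d {f g : Vertex d n → ℤ} → (∀ v → f v ≡ g v) → ∑ᵛ d f ≡ ∑ᵛ d g
∑ᵛ-cong zero    f≗g = f≗g []
∑ᵛ-cong {n} (suc d) f≗g = ℤ∑.sum-cong-≗ {n} (λ i → ∑ᵛ-cong d (λ w → f≗g (i ∷ w)))

∑ᵛ-distrib-+ : ∀ {n} d (f g : Vertex d n → ℤ) → ∑ᵛ d (λ v → f v +ᶻ g v) ≡ ∑ᵛ d f +ᶻ ∑ᵛ d g
∑ᵛ-distrib-+ zero    f g = refl
∑ᵛ-distrib-+ {n} (suc d) f g =
  trans (ℤ∑.sum-cong-≗ {n} (λ i → ∑ᵛ-distrib-+ d _ _)) (ℤ∑.∑-distrib-+ {n} _ _)

∑ᵛ-const : ∀ {n} d c → ∑ᵛ {n} d (λ _ → c) ≡ + (n ^ d) *ᶻ c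
∑ᵛ-const         zero    c = sym (ℤP.*-identityˡ c)
∑ᵛ-const {n = n} (suc d) c = begin
  ℤ∑.sum {n} (λ _ → ∑ᵛ d (λ _ → c))  ≡⟨ ℤ∑.sum-cong-≗ {n} (λ _ → ∑ᵛ-const d c) ⟩
  ∑ᶻ n (λ _ → + (n ^ d) *ᶻ c)        ≡⟨ ∑ᶻ-const n _ ⟩
  + n *ᶻ (+ (n ^ d) *ᶻ c)            ≡⟨ ℤP.*-assoc (+ n) (+ (n ^ d)) c ⟨
  + n *ᶻ + (n ^ d) *ᶻ c              ≡⟨ cong (_*ᶻ c) (ℤP.pos-* n (n ^ d)) ⟨
  + (n * n ^ d) *ᶻ c                 ∎
  where open ≡-Reasoning

∑ᵛ-zero : ∀ {n} d → ∑ᵛ {n} d (λ _ → + 0) ≡ + 0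
∑ᵛ-zero {n} d = trans (∑ᵛ-const d (+ 0)) (ℤP.*-zeroʳ (+ (n ^ d)))

∑ᵛ-∑-comm : ∀ {n} d k (f : Fin k → Vertex d n → ℤ) →
  ∑ᵛ d (λ v → ℤ∑.sum (λ i → f i v)) ≡ ℤ∑.sum (λ i → ∑ᵛ d (f i))
∑ᵛ-∑-comm zero    k f = refl
∑ᵛ-∑-comm {n} (suc d) k f =
  trans (ℤ∑.sum-cong-≗ {n} (λ j → ∑ᵛ-∑-comm d k (λ i w → f i (j ∷ w)))) (ℤ∑.∑-comm {n} {k} _)

∑ᵛ-when-≡ : ∀ {n} d (p : Vertex d n) c → ∑ᵛ d (λ v → when (v ≟ᵛ p) c) ≡ c
∑ᵛ-when-≡         zero    [] c = refl
∑ᵛ-when-≡ {n = n} (suc d) (p ∷ ps) c = begin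
  ℤ∑.sum (λ i → ∑ᵛ d (λ w → when ((i ∷ w) ≟ᵛ (p ∷ ps)) c))       ≡⟨ ℤ∑.sum-cong-≗ {n} (λ i → ∑ᵛ-cong d (when-∷ i)) ⟩
  ℤ∑.sum (λ i → ∑ᵛ d (λ w → when (i FinP.≟ p) (when (w ≟ᵛ ps) c))) ≡⟨ ℤ∑.sum-cong-≗ {n} slice ⟩
  ℤ∑.sum (λ i → when (i FinP.≟ p) c)                              ≡⟨ ∑-when-unique n (FinP._≟ p) (λ _ → c) p refl (λ _ i≡p → i≡p) ⟩
  c                                                               ∎
  where
  open ≡-Reasoning
  when-∷ : ∀ i w → when ((i ∷ w) ≟ᵛ (p ∷ ps)) c ≡ when (i FinP.≟ p) (when (w ≟ᵛ ps) c)
  when-∷ i w = split (i FinP.≟ p) (w ≟ᵛ ps)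
    where
    split : (i≟p : Dec (i ≡ p)) (w≟ps : Dec (w ≡ ps)) → when ((i ∷ w) ≟ᵛ (p ∷ ps)) c ≡ when i≟p (when w≟ps c)
    split (yes refl) (yes refl) = when-yes ((i ∷ w) ≟ᵛ (p ∷ ps)) c refl
    split (yes refl) (no w≢ps)  = when-no ((i ∷ w) ≟ᵛ (p ∷ ps)) c (w≢ps ∘ VecP.∷-injectiveʳ)
    split (no i≢p)   _          = when-no ((i ∷ w) ≟ᵛ (p ∷ ps)) c (i≢p ∘ VecP.∷-injectiveˡ)
  slice : ∀ i → ∑ᵛ d (λ w → when (i FinP.≟ p) (when (w ≟ᵛ ps) c)) ≡ when (i FinP.≟ p) c
  slice i with i FinP.≟ p
  ... | yes _ = ∑ᵛ-when-≡ d ps c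
  ... | no _  = ∑ᵛ-zero d

∑ᵛ-supported-on-images : ∀ {n} d k (f : Vertex d n → ℤ) (a b : Fin k → Vertex d n) →
  (∀ i j → a i ≡ a j → i ≡ j) → (∀ i j → b i ≡ b j → i ≡ j) → (∀ i j → a i ≢ b j) →
  (∀ v → (∀ i → v ≢ a i) → (∀ i → v ≢ b i) → f v ≡ + 0) →
  ∑ᵛ d f ≡ ℤ∑.sum (λ i → f (a i) +ᶻ f (b i))
∑ᵛ-supported-on-images d k f a b a-inj b-inj a≢b f-vanishes = begin
  ∑ᵛ d f
    ≡⟨ ∑ᵛ-cong d (λ v → trans (decompose v) (sym (ℤ∑.∑-distrib-+ {k} _ _))) ⟩
  ∑ᵛ d (λ v → ℤ∑.sum (λ i → when (v ≟ᵛ a i) (f (a i)) +ᶻ when (v ≟ᵛ b i) (f (b i))))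
    ≡⟨ ∑ᵛ-∑-comm d k _ ⟩
  ℤ∑.sum (λ i → ∑ᵛ d (λ v → when (v ≟ᵛ a i) (f (a i)) +ᶻ when (v ≟ᵛ b i) (f (b i))))
    ≡⟨ ℤ∑.sum-cong-≗ {k} (λ i → trans (∑ᵛ-distrib-+ d _ _)
                                      (cong₂ _+ᶻ_ (∑ᵛ-when-≡ d (a i) _) (∑ᵛ-when-≡ d (b i) _))) ⟩
  ℤ∑.sum (λ i → f (a i) +ᶻ f (b i))
    ∎
  where
  open ≡-Reasoning
  restrict : (Fin k → Vertex _ _) → Vertex _ _ → ℤ
  restrict c v = ℤ∑.sum (λ i → when (v ≟ᵛ c i) (f (c i)))
  restrict-image : ∀ c → (∀ i j → c i ≡ c j → i ≡ j) → ∀ j → restrict c (c j) ≡ f (c j)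
  restrict-image c c-inj j = ∑-when-unique k (λ i → c j ≟ᵛ c i) (f ∘ c) j refl (λ i cj≡ci → c-inj i j (sym cj≡ci))
  restrict-outside : ∀ c v → (∀ i → v ≢ c i) → restrict c v ≡ + 0
  restrict-outside c v v∉c = ∑-when-none k (λ i → v ≟ᵛ c i) (f ∘ c) v∉c
  decompose : ∀ v → f v ≡ restrict a v +ᶻ restrict b v
  decompose v with FinP.any? (λ i → v ≟ᵛ a i) | FinP.any? (λ i → v ≟ᵛ b i)
  ... | yes (j , refl) | _ =
    sym (trans (cong₂ _+ᶻ_ (restrict-image a a-inj j) (restrict-outside b (a j) (a≢b j))) (ℤP.+-identityʳ _))
  ... | no v∉a | yes (j , refl) =
    sym (trans (cong₂ _+ᶻ_ (restrict-outside a (b j) (λ i bj≡ai → a≢b i j (sym bj≡ai))) (restrict-image b b-inj j)) (ℤP.+-identityˡ _))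
  ... | no v∉a | no v∉b =
    trans (f-vanishes v (λ i e → v∉a (i , e)) (λ i e → v∉b (i , e)))
          (sym (cong₂ _+ᶻ_ (restrict-outside a v (λ i e → v∉a (i , e))) (restrict-outside b v (λ i e → v∉b (i , e)))))

-- Checkerboard colouring

true≢false : true ≢ false
true≢false ()

odd : ℕ → Bool
odd zero    = false
odd (suc k) = not (odd k)

odd-+ : ∀ a b → odd (a + b) ≡ odd a xor odd b
odd-+ zero    b = refl
odd-+ (suc a) b = trans (cong not (odd-+ a b)) (BoolP.not-distribˡ-xor (odd a) (odd b))

odd-double : ∀ a → odd (a + a) ≡ false
odd-double a = trans (odd-+ a a) (BoolP.xor-same (odd a))

colour : ∀ {d n} → Vertex d n → Bool
colour []       = false
colour (x ∷ xs) = odd (toℕ x) xor colour xs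

sign : Bool → ℤ
sign false = + 1
sign true  = - + 1

σ : ∀ {d n} → Vertex d n → ℤ
σ v = sign (colour v)

sign-not : ∀ b → sign (not b) ≡ - sign b
sign-not false = refl
sign-not true  = refl

sign-xor : ∀ a b → sign (a xor b) ≡ sign a *ᶻ sign b
sign-xor false false = refl
sign-xor false true  = refl
sign-xor true  false = refl
sign-xor true  true  = refl

sign-squared : ∀ b → sign b *ᶻ sign b ≡ + 1
sign-squared false = refl
sign-squared true  = refl

sign-opposite : ∀ a b → a xor b ≡ true → sign a ≡ - sign b
sign-opposite false true  _ = refl
sign-opposite true  false _ = refl
sign-opposite false false ()
sign-opposite true  true  ()

∣sign∣ : ∀ b → ∣ sign b ∣ ≡ 1
∣sign∣ false = refl
∣sign∣ true  = refl

step-odd : ∀ {n} {x y : Fin n} → Step x y → odd (toℕ y) ≡ not (odd (toℕ x))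
step-odd (inj₁ y≡1+x) rewrite y≡1+x = refl
step-odd (inj₂ x≡1+y) rewrite x≡1+y = sym (BoolP.not-involutive _)

colour-adj : ∀ {d n} {v w : Vertex d n} → Adj v w → colour w ≡ not (colour v)
colour-adj (here {x = x} {xs = xs} s) =
  trans (cong (_xor colour xs) (step-odd s)) (sym (BoolP.not-distribˡ-xor (odd (toℕ x)) (colour xs)))
colour-adj (there {x = x} {xs = xs} p) =
  trans (cong (odd (toℕ x) xor_) (colour-adj p)) (sym (BoolP.not-distribʳ-xor (odd (toℕ x)) (colour xs)))

σ-adj : ∀ {d n} {v w : Vertex d n} → Adj v w → σ w ≡ - σ v
σ-adj {v = v} p = trans (cong sign (colour-adj p)) (sign-not (colour v))

-- Coordinates and the potential

∣-∣-triangle : ∀ x y z → ∣ x -ᶻ z ∣ ≤ ∣ x -ᶻ y ∣ + ∣ y -ᶻ z ∣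
∣-∣-triangle x y z =
  subst (λ u → ∣ u ∣ ≤ ∣ x -ᶻ y ∣ + ∣ y -ᶻ z ∣) (telescope x y z) (ℤP.∣i+j∣≤∣i∣+∣j∣ (x -ᶻ y) (y -ᶻ z))
  where
  telescope : ∀ x y z → (x -ᶻ y) +ᶻ (y -ᶻ z) ≡ x -ᶻ z
  telescope = ℤ-solve

∣a-a∣≤1 : ∀ a → ∣ a -ᶻ a ∣ ≤ 1
∣a-a∣≤1 a rewrite ℤP.+-inverseʳ a = z≤n

∣-∣-two-steps : ∀ a b c → ∣ a -ᶻ b ∣ ≤ 1 → ∣ b -ᶻ c ∣ ≤ 1 → ∣ a -ᶻ c ∣ ≤ 2
∣-∣-two-steps a b c ab bc = ℕP.≤-trans (∣-∣-triangle a b c) (ℕP.+-mono-≤ ab bc)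

∣sign*[p*q]∣≤2∣p∣ : ∀ b p q → ∣ q ∣ ≤ 2 → ∣ sign b *ᶻ (p *ᶻ q) ∣ ≤ 2 * ∣ p ∣
∣sign*[p*q]∣≤2∣p∣ b p q ∣q∣≤2 = begin
  ∣ sign b *ᶻ (p *ᶻ q) ∣          ≡⟨ ℤP.abs-* (sign b) (p *ᶻ q) ⟩
  ∣ sign b ∣ * ∣ p *ᶻ q ∣         ≡⟨ cong₂ _*_ (∣sign∣ b) (ℤP.abs-* p q) ⟩
  1 * (∣ p ∣ * ∣ q ∣)             ≡⟨ ℕP.*-identityˡ _ ⟩
  ∣ p ∣ * ∣ q ∣                   ≤⟨ ℕP.*-monoʳ-≤ ∣ p ∣ ∣q∣≤2 ⟩
  ∣ p ∣ * 2                       ≡⟨ ℕP.*-comm ∣ p ∣ 2 ⟩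
  2 * ∣ p ∣                       ∎
  where open ℕP.≤-Reasoning

step-≤1 : ∀ {n} {x y : Fin n} → Step x y → ∣ + toℕ x -ᶻ + toℕ y ∣ ≤ 1
step-≤1 {x = x} (inj₁ y≡1+x) rewrite y≡1+x = ℕP.≤-reflexive (cong ∣_∣ (down (+ toℕ x)))
  where
  down : ∀ a → a -ᶻ (+ 1 +ᶻ a) ≡ - + 1
  down = ℤ-solve
step-≤1 {y = y} (inj₂ x≡1+y) rewrite x≡1+y = ℕP.≤-reflexive (cong ∣_∣ (up (+ toℕ y)))
  where
  up : ∀ a → + 1 +ᶻ a -ᶻ a ≡ + 1
  up = ℤ-solve

x-coord : ∀ {d n} → Vertex (suc d) n → ℤ
x-coord (x ∷ _) = + toℕ x

y-coord : ∀ {d n} → Vertex (suc (suc d)) n → ℤ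
y-coord (_ ∷ y ∷ _) = + toℕ y

adj-x-coord : ∀ {d n} {v w : Vertex (suc d) n} → Adj v w → ∣ x-coord v -ᶻ x-coord w ∣ ≤ 1
adj-x-coord (here s)          = step-≤1 s
adj-x-coord (there {x = x} _) = ∣a-a∣≤1 (+ toℕ x)

adj-y-coord : ∀ {d n} {v w : Vertex (suc (suc d)) n} → Adj v w → ∣ y-coord v -ᶻ y-coord w ∣ ≤ 1
adj-y-coord (here {xs = y ∷ _} _)                     = ∣a-a∣≤1 (+ toℕ y)
adj-y-coord (there {xs = _ ∷ _} {ys = _ ∷ _} v~w)     = adj-x-coord v~w

flux : ∀ {d n} → Vertex (suc (suc d)) n → Vertex (suc (suc d)) n → ℤ
flux v w = σ v *ᶻ (y-coord v *ᶻ (x-coord w -ᶻ x-coord v))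

Φ : ∀ {d n} → Dimer (suc (suc d)) n → ℤ
Φ P = ∑ᵛ _ (λ v → flux v (partner P v))

Φ-difference : ∀ {d n} (P P′ : Dimer (suc (suc d)) n) →
  Φ P′ -ᶻ Φ P ≡ ∑ᵛ _ (λ v → flux v (partner P′ v) -ᶻ flux v (partner P v))
Φ-difference {d} P P′ = begin
  Φ P′ -ᶻ Φ P                                   ≡⟨ cong (_-ᶻ Φ P) (∑ᵛ-cong (suc (suc d)) (λ v → split (flux v (partner P′ v)) (flux v (partner P v)))) ⟩
  ∑ᵛ _ (λ v → flux v (partner P v) +ᶻ Δ v) -ᶻ Φ P ≡⟨ cong (_-ᶻ Φ P) (∑ᵛ-distrib-+ (suc (suc d)) (λ v → flux v (partner P v)) Δ) ⟩
  Φ P +ᶻ ∑ᵛ _ Δ -ᶻ Φ P                          ≡⟨ cancel (Φ P) (∑ᵛ _ Δ) ⟩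
  ∑ᵛ _ Δ                                        ∎
  where
  open ≡-Reasoning
  Δ : Vertex _ _ → ℤ
  Δ v = flux v (partner P′ v) -ᶻ flux v (partner P v)
  split : ∀ x y → x ≡ y +ᶻ (x -ᶻ y)
  split = ℤ-solve
  cancel : ∀ x y → x +ᶻ y -ᶻ x ≡ y
  cancel = ℤ-solve

-- Switching an alternating cycle

module UnitStepSequence (y : ℕ → ℤ) (unit-step : ∀ i → ∣ y i -ᶻ y (suc i) ∣ ≤ 1) where

  drift : ∀ i r → ∣ y i -ᶻ y (i + r) ∣ ≤ r
  drift i zero    rewrite ℕP.+-identityʳ i | ℤP.+-inverseʳ (y i) = z≤n
  drift i (suc r) rewrite ℕP.+-suc i r =
    ℕP.≤-trans (∣-∣-triangle (y i) (y (suc i)) (y (suc (i + r)))) (ℕP.+-mono-≤ (unit-step i) (drift (suc i) r))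

  closed-spread : ∀ k → y (k + k) ≡ y 0 → ∑ⁿ (k + k) (λ i → ∣ y (suc i) -ᶻ y 0 ∣) ≤ k * k
  closed-spread k closed = begin
    ∑ⁿ (k + k) φ                                  ≡⟨ ∑ⁿ-split k k φ ⟩
    ∑ⁿ k φ + ∑ⁿ k (λ i → φ (k + i))               ≤⟨ ℕP.+-mono-≤ (∑ⁿ-mono-≤ k outward) (∑ⁿ-mono-≤ k homeward) ⟩
    ∑ⁿ k suc + ∑ⁿ k (λ i → k ∸ suc i)             ≡⟨ ℕ∑.∑-distrib-+ {k} (suc ∘ toℕ) (λ i → k ∸ suc (toℕ i)) ⟨
    ∑ⁿ k (λ i → suc i + (k ∸ suc i))              ≡⟨ ℕ∑.sum-cong-≗ {k} (λ i → ℕP.m+[n∸m]≡n (FinP.toℕ<n i)) ⟩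
    ∑ⁿ k (λ _ → k)                                ≡⟨ ∑ⁿ-const k k ⟩
    k * k                                         ∎
    where
    open ℕP.≤-Reasoning
    φ : ℕ → ℕ
    φ i = ∣ y (suc i) -ᶻ y 0 ∣
    outward : ∀ i → i < k → φ i ≤ suc i
    outward i _ = subst (_≤ suc i) (ℤP.∣i-j∣≡∣j-i∣ (y 0) (y (suc i))) (drift 0 (suc i))
    homeward : ∀ i → i < k → φ (k + i) ≤ k ∸ suc i
    homeward i i<k = subst (λ z → ∣ y (suc (k + i)) -ᶻ z ∣ ≤ k ∸ suc i) (trans (cong y back) closed)
                           (drift (suc (k + i)) (k ∸ suc i))
      where
      back : suc (k + i) + (k ∸ suc i) ≡ k + k
      back = begin-equality
        suc (k + i) + (k ∸ suc i)  ≡⟨ cong (_+ (k ∸ suc i)) (ℕP.+-suc k i) ⟨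
        k + suc i + (k ∸ suc i)    ≡⟨ ℕP.+-assoc k (suc i) (k ∸ suc i) ⟩
        k + (suc i + (k ∸ suc i))  ≡⟨ cong (_+_ k) (ℕP.m+[n∸m]≡n i<k) ⟩
        k + k                      ∎

interleave : ∀ {A : Set} → (ℕ → A) → (ℕ → A) → ℕ → A
interleave f g zero    = f 0
interleave f g (suc i) = interleave g (f ∘ suc) i

interleave-even : ∀ {A : Set} (f g : ℕ → A) j → interleave f g (j + j) ≡ f j
interleave-even f g zero    = refl
interleave-even f g (suc j) =
  trans (cong (interleave g (f ∘ suc)) (ℕP.+-suc j j)) (interleave-even (f ∘ suc) (g ∘ suc) j)

interleave-steps : ∀ {A : Set} (R : A → A → Set) (f g : ℕ → A) →
  (∀ j → R (f j) (g j)) → (∀ j → R (g j) (f (suc j))) →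
  ∀ i → R (interleave f g i) (interleave f g (suc i))
interleave-steps R f g fg gf zero    = fg 0
interleave-steps R f g fg gf (suc i) = interleave-steps R g (f ∘ suc) gf (fg ∘ suc) i

next-mod : ∀ m j → next {m} (j mod suc m) ≡ suc j mod suc m
next-mod m j = FinP.toℕ-injective (begin
  toℕ (next (j mod suc m))                  ≡⟨ FinP.toℕ-fromℕ< _ ⟩
  suc (toℕ (j mod suc m)) % suc m           ≡⟨ cong (λ r → suc r % suc m) (FinP.toℕ-fromℕ< _) ⟩
  (1 + j % suc m) % suc m                   ≡⟨ DivModP.%-distribˡ-+ 1 (j % suc m) (suc m) ⟩
  (1 % suc m + j % suc m % suc m) % suc m   ≡⟨ cong (λ r → (1 % suc m + r) % suc m) (DivModP.m%n%n≡m%n j (suc m)) ⟩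
  (1 % suc m + j % suc m) % suc m           ≡⟨ DivModP.%-distribˡ-+ 1 j (suc m) ⟨
  suc j % suc m                             ≡⟨ FinP.toℕ-fromℕ< _ ⟨
  toℕ (suc j mod suc m)                     ∎)
  where open ≡-Reasoning

toℕ-mod : ∀ m (i : Fin (suc m)) → toℕ i mod suc m ≡ i
toℕ-mod m i = FinP.toℕ-injective (trans (FinP.toℕ-fromℕ< _) (DivModP.m<n⇒m%n≡m (FinP.toℕ<n i)))

mod-self : ∀ m → suc m mod suc m ≡ 0 mod suc m
mod-self m = FinP.toℕ-injective (trans (FinP.toℕ-fromℕ< _) (trans (DivModP.n%n≡0 (suc m)) (sym (FinP.toℕ-fromℕ< (DivModP.m%n<n 0 (suc m))))))

module Switch {d n k : ℕ} {M M′ : Dimer (suc (suc d)) n} (sc : SwitchCycle k M M′) where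
  open SwitchCycle sc

  K : ℕ
  K = suc m

  A B : ℕ → Vertex (suc (suc d)) n
  A j = a (j mod K)
  B j = b (j mod K)

  XA XB YA YB : ℕ → ℤ
  XA = x-coord ∘ A
  XB = x-coord ∘ B
  YA = y-coord ∘ A
  YB = y-coord ∘ B

  A-periodic : A K ≡ A 0
  A-periodic = cong a (mod-self m)

  B-periodic : B K ≡ B 0
  B-periodic = cong b (mod-self m)

  A-old : ∀ j → partner M (A j) ≡ B j
  A-old j = dimer (j mod K)

  B-old : ∀ j → partner M (B j) ≡ A j
  B-old j = trans (cong (partner M) (sym (A-old j))) (invol M (A j))

  B-new : ∀ j → partner M′ (B j) ≡ A (suc j)
  B-new j = trans (sw₁ (j mod K)) (cong a (next-mod m j))

  A-new : ∀ j → partner M′ (A (suc j)) ≡ B j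
  A-new j = trans (cong (partner M′ ∘ a) (sym (next-mod m j))) (sw₂ (j mod K))

  A~B : ∀ j → Adj (A j) (B j)
  A~B j = subst (Adj (A j)) (A-old j) (adj M (A j))

  B~A : ∀ j → Adj (B j) (A (suc j))
  B~A j = subst (Adj (B j)) (cong a (next-mod m j)) (edge (j mod K))

  s : ℤ
  s = σ (A 0)

  σA : ∀ j → σ (A j) ≡ s
  σA zero    = refl
  σA (suc j) = begin
    σ (A (suc j))  ≡⟨ σ-adj (B~A j) ⟩
    - σ (B j)      ≡⟨ cong -_ (σ-adj (A~B j)) ⟩
    - - σ (A j)    ≡⟨ ℤP.neg-involutive _ ⟩
    σ (A j)        ≡⟨ σA j ⟩
    s              ∎
    where open ≡-Reasoning

  σB : ∀ j → σ (B j) ≡ - s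
  σB j = trans (σ-adj (A~B j)) (cong -_ (σA j))

  Δ : Vertex (suc (suc d)) n → ℤ
  Δ v = flux v (partner M′ v) -ᶻ flux v (partner M v)

  Δ-outside : ∀ v → (∀ i → v ≢ a i) → (∀ i → v ≢ b i) → Δ v ≡ + 0
  Δ-outside v v∉a v∉b rewrite same v v∉a v∉b = ℤP.+-inverseʳ (flux v (partner M v))

  -- Measuring heights from c = y(A 0) only adds the telescoping term W, and makes the factors y - c small.
  c : ℤ
  c = YA 0

  U W : ℕ → ℤ
  U j = s *ᶻ ((YA (suc j) -ᶻ c) *ᶻ (XB j -ᶻ XB (suc j))) +ᶻ s *ᶻ ((YB j -ᶻ c) *ᶻ (XA j -ᶻ XA (suc j)))
  W j = s *ᶻ c *ᶻ (XA j +ᶻ XB j)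

  Δ-pair : ∀ j → Δ (A (suc j)) +ᶻ Δ (B j) ≡ U j +ᶻ (W j -ᶻ W (suc j))
  Δ-pair j rewrite A-new j | A-old (suc j) | B-new j | B-old j | σA (suc j) | σB j =
    identity s c (YA (suc j)) (YB j) (XA j) (XA (suc j)) (XB j) (XB (suc j))
    where
    identity : ∀ s c ya′ yb xa xa′ xb xb′ →
      s *ᶻ (ya′ *ᶻ (xb -ᶻ xa′)) -ᶻ s *ᶻ (ya′ *ᶻ (xb′ -ᶻ xa′)) +ᶻ
      ((- s) *ᶻ (yb *ᶻ (xa′ -ᶻ xb)) -ᶻ (- s) *ᶻ (yb *ᶻ (xa -ᶻ xb)))
      ≡ s *ᶻ ((ya′ -ᶻ c) *ᶻ (xb -ᶻ xb′)) +ᶻ s *ᶻ ((yb -ᶻ c) *ᶻ (xa -ᶻ xa′))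
        +ᶻ (s *ᶻ c *ᶻ (xa +ᶻ xb) -ᶻ s *ᶻ c *ᶻ (xa′ +ᶻ xb′))
    identity = ℤ-solve

  Φ-switch : Φ M′ -ᶻ Φ M ≡ ∑ᶻ K U
  Φ-switch = begin
    Φ M′ -ᶻ Φ M                                               ≡⟨ Φ-difference M M′ ⟩
    ∑ᵛ _ Δ                                                    ≡⟨ ∑ᵛ-supported-on-images _ K Δ a b a-inj b-inj a≢b Δ-outside ⟩
    ℤ∑.sum (λ i → Δ (a i) +ᶻ Δ (b i))                         ≡⟨ ℤ∑.sum-cong-≗ {K} (λ i → cong (λ i′ → Δ (a i′) +ᶻ Δ (b i′)) (sym (toℕ-mod m i))) ⟩
    ∑ᶻ K (λ j → Δ (A j) +ᶻ Δ (B j))                           ≡⟨ ∑ᶻ-distrib-+ K (Δ ∘ A) (Δ ∘ B) ⟩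
    ∑ᶻ K (Δ ∘ A) +ᶻ ∑ᶻ K (Δ ∘ B)                              ≡⟨ cong (_+ᶻ ∑ᶻ K (Δ ∘ B)) (∑ᶻ-rotate K (Δ ∘ A) (cong Δ A-periodic)) ⟨
    ∑ᶻ K (Δ ∘ A ∘ suc) +ᶻ ∑ᶻ K (Δ ∘ B)                        ≡⟨ ∑ᶻ-distrib-+ K (Δ ∘ A ∘ suc) (Δ ∘ B) ⟨
    ∑ᶻ K (λ j → Δ (A (suc j)) +ᶻ Δ (B j))                     ≡⟨ ∑ᶻ-cong K (λ j _ → Δ-pair j) ⟩
    ∑ᶻ K (λ j → U j +ᶻ (W j -ᶻ W (suc j)))                    ≡⟨ ∑ᶻ-distrib-+ K U (λ j → W j -ᶻ W (suc j)) ⟩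
    ∑ᶻ K U +ᶻ ∑ᶻ K (λ j → W j -ᶻ W (suc j))                   ≡⟨ cong (∑ᶻ K U +ᶻ_) (∑ᶻ-telescope K W) ⟩
    ∑ᶻ K U +ᶻ (W 0 -ᶻ W K)                                    ≡⟨ cong (λ w → ∑ᶻ K U +ᶻ (W 0 -ᶻ w)) W-periodic ⟩
    ∑ᶻ K U +ᶻ (W 0 -ᶻ W 0)                                    ≡⟨ cong (∑ᶻ K U +ᶻ_) (ℤP.+-inverseʳ (W 0)) ⟩
    ∑ᶻ K U +ᶻ + 0                                             ≡⟨ ℤP.+-identityʳ _ ⟩
    ∑ᶻ K U                                                    ∎
    where
    open ≡-Reasoning
    W-periodic : W K ≡ W 0
    W-periodic rewrite A-periodic | B-periodic = refl

  y : ℕ → ℤ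
  y = interleave YA YB

  spread : ℕ → ℕ
  spread i = ∣ y (suc i) -ᶻ c ∣

  U-bound : ∀ j → ∣ U j ∣ ≤ 2 * (spread (j + j) + spread (suc (j + j)))
  U-bound j = begin
    ∣ U j ∣
      ≤⟨ ℤP.∣i+j∣≤∣i∣+∣j∣ (s *ᶻ (hA *ᶻ dB)) (s *ᶻ (hB *ᶻ dA)) ⟩
    ∣ s *ᶻ (hA *ᶻ dB) ∣ + ∣ s *ᶻ (hB *ᶻ dA) ∣
      ≤⟨ ℕP.+-mono-≤ (∣sign*[p*q]∣≤2∣p∣ (colour (A 0)) hA dB ∣dB∣≤2) (∣sign*[p*q]∣≤2∣p∣ (colour (A 0)) hB dA ∣dA∣≤2) ⟩
    2 * ∣ hA ∣ + 2 * ∣ hB ∣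
      ≡⟨ ℕP.*-distribˡ-+ 2 ∣ hA ∣ ∣ hB ∣ ⟨
    2 * (∣ hA ∣ + ∣ hB ∣)
      ≡⟨ cong (_*_ 2) (ℕP.+-comm ∣ hA ∣ ∣ hB ∣) ⟩
    2 * (∣ hB ∣ + ∣ hA ∣)
      ≡⟨ cong₂ (λ u v → 2 * (∣ u -ᶻ c ∣ + ∣ v -ᶻ c ∣)) (interleave-even YB (YA ∘ suc) j) (interleave-even (YA ∘ suc) (YB ∘ suc) j) ⟨
    2 * (spread (j + j) + spread (suc (j + j)))
      ∎
    where
    open ℕP.≤-Reasoning
    hA hB dA dB : ℤ
    hA = YA (suc j) -ᶻ c
    hB = YB j -ᶻ c
    dA = XA j -ᶻ XA (suc j)
    dB = XB j -ᶻ XB (suc j)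
    ∣dA∣≤2 : ∣ dA ∣ ≤ 2
    ∣dA∣≤2 = ∣-∣-two-steps (XA j) (XB j) (XA (suc j)) (adj-x-coord (A~B j)) (adj-x-coord (B~A j))
    ∣dB∣≤2 : ∣ dB ∣ ≤ 2
    ∣dB∣≤2 = ∣-∣-two-steps (XB j) (XA (suc j)) (XB (suc j)) (adj-x-coord (B~A j)) (adj-x-coord (A~B (suc j)))

  Φ-switch-bound : ∣ Φ M′ -ᶻ Φ M ∣ ≤ 2 * (K * K)
  Φ-switch-bound = begin
    ∣ Φ M′ -ᶻ Φ M ∣                                              ≡⟨ cong ∣_∣ Φ-switch ⟩
    ∣ ∑ᶻ K U ∣                                                   ≤⟨ ∣∑ᶻ∣≤∑ⁿ∣∣ K U ⟩
    ∑ⁿ K (λ j → ∣ U j ∣)                                         ≤⟨ ∑ⁿ-mono-≤ K (λ j _ → U-bound j) ⟩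
    ∑ⁿ K (λ j → 2 * (spread (j + j) + spread (suc (j + j))))     ≡⟨ ℕ∑.*-distribˡ-sum {K} 2 (λ j → spread (toℕ j + toℕ j) + spread (suc (toℕ j + toℕ j))) ⟨
    2 * ∑ⁿ K (λ j → spread (j + j) + spread (suc (j + j)))       ≡⟨ cong (_*_ 2) (∑ⁿ-pairs K spread) ⟨
    2 * ∑ⁿ (K + K) spread                                        ≤⟨ ℕP.*-monoʳ-≤ 2 (UnitStepSequence.closed-spread y unit-step K closed) ⟩
    2 * (K * K)                                                  ∎
    where
    open ℕP.≤-Reasoning
    unit-step : ∀ i → ∣ y i -ᶻ y (suc i) ∣ ≤ 1
    unit-step = interleave-steps (λ u v → ∣ u -ᶻ v ∣ ≤ 1) YA YB (adj-y-coord ∘ A~B) (adj-y-coord ∘ B~A)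
    closed : y (K + K) ≡ y 0
    closed = trans (interleave-even YA YB K) (cong y-coord A-periodic)

switch-bound : ∀ {d n k} {M M′ : Dimer (suc (suc d)) n} → SwitchCycle k M M′ → ∣ Φ M′ -ᶻ Φ M ∣ ≤ 2 * (k * k)
switch-bound sc rewrite SwitchCycle.k≡ sc = Switch.Φ-switch-bound sc

walk-bound : ∀ {d n ℓ} t (M N : Dimer (suc (suc d)) n) → Walk ℓ t M N → ∣ Φ N -ᶻ Φ M ∣ ≤ t * (2 * (ℓ * ℓ))
walk-bound {d} zero M N M≈N rewrite ∑ᵛ-cong (suc (suc d)) (λ v → cong (flux v) (M≈N v)) | ℤP.+-inverseʳ (Φ N) = z≤n
walk-bound {ℓ = ℓ} (suc t) M N (M′ , (k , _ , k≤ℓ , sc) , walk) = begin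
  ∣ Φ N -ᶻ Φ M ∣                             ≤⟨ ∣-∣-triangle (Φ N) (Φ M′) (Φ M) ⟩
  ∣ Φ N -ᶻ Φ M′ ∣ + ∣ Φ M′ -ᶻ Φ M ∣          ≤⟨ ℕP.+-mono-≤ (walk-bound t M′ N walk) (switch-bound sc) ⟩
  t * (2 * (ℓ * ℓ)) + 2 * (k * k)            ≤⟨ ℕP.+-monoʳ-≤ (t * (2 * (ℓ * ℓ))) (ℕP.*-monoʳ-≤ 2 (ℕP.*-mono-≤ k≤ℓ k≤ℓ)) ⟩
  t * (2 * (ℓ * ℓ)) + 2 * (ℓ * ℓ)            ≡⟨ ℕP.+-comm (t * (2 * (ℓ * ℓ))) (2 * (ℓ * ℓ)) ⟩
  suc t * (2 * (ℓ * ℓ))                      ∎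
  where open ℕP.≤-Reasoning

-- Matchings of the grid, stacked into the cube

Stepℕ : ℕ → ℕ → Set
Stepℕ a b = (b ≡ suc a) ⊎ (a ≡ suc b)

-- A perfect matching of the grid {0, …, n ∸ 1}², as a partner map on ℕ × ℕ constrained only on the grid.
record GridMatching (n : ℕ) : Set where
  field
    match      : ℕ → ℕ → ℕ × ℕ
    bounded    : ∀ {x y} → x < n → y < n → proj₁ (match x y) < n × proj₂ (match x y) < n
    unit-step  : ∀ {x y} → x < n → y < n →
                 (proj₂ (match x y) ≡ y × Stepℕ x (proj₁ (match x y))) ⊎
                 (proj₁ (match x y) ≡ x × Stepℕ y (proj₂ (match x y)))
    involutive : ∀ {x y} → x < n → y < n → match (proj₁ (match x y)) (proj₂ (match x y)) ≡ (x , y)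

transpose : ∀ {n} → GridMatching n → GridMatching n
transpose G = record
  { match      = λ x y → swap (match y x)
  ; bounded    = λ x<n y<n → swap (bounded y<n x<n)
  ; unit-step  = λ x<n y<n → ⊎-swap (unit-step y<n x<n)
  ; involutive = λ x<n y<n → cong swap (involutive y<n x<n)
  }
  where open GridMatching G

module _ {n : ℕ} (G : GridMatching n) where
  open GridMatching G

  private
    coords : Fin n → Fin n → Fin n × Fin n
    coords x y = fromℕ< (proj₁ (bounded (FinP.toℕ<n x) (FinP.toℕ<n y))) ,
                 fromℕ< (proj₂ (bounded (FinP.toℕ<n x) (FinP.toℕ<n y)))

    toℕ-coords : ∀ x y → (toℕ (proj₁ (coords x y)) , toℕ (proj₂ (coords x y))) ≡ match (toℕ x) (toℕ y)
    toℕ-coords x y = cong₂ _,_ (FinP.toℕ-fromℕ< _) (FinP.toℕ-fromℕ< _)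

    grid-partner : Vertex 2 n → Vertex 2 n
    grid-partner (x ∷ y ∷ []) = proj₁ (coords x y) ∷ proj₂ (coords x y) ∷ []

    grid-adj : ∀ v → Adj v (grid-partner v)
    grid-adj (x ∷ y ∷ []) with unit-step (FinP.toℕ<n x) (FinP.toℕ<n y) | toℕ-coords x y
    ... | inj₁ (y′≡y , step) | ≡coords =
      subst (λ w → Adj (x ∷ y ∷ []) (proj₁ (coords x y) ∷ w ∷ []))
            (sym (FinP.toℕ-injective (trans (cong proj₂ ≡coords) y′≡y)))
            (here (subst (Stepℕ (toℕ x)) (sym (cong proj₁ ≡coords)) step))
    ... | inj₂ (x′≡x , step) | ≡coords =
      subst (λ w → Adj (x ∷ y ∷ []) (w ∷ proj₂ (coords x y) ∷ []))
            (sym (FinP.toℕ-injective (trans (cong proj₁ ≡coords) x′≡x)))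
            (there (here (subst (Stepℕ (toℕ y)) (sym (cong proj₂ ≡coords)) step)))

    grid-invol : ∀ v → grid-partner (grid-partner v) ≡ v
    grid-invol (x ∷ y ∷ []) = cong₂ (λ u w → u ∷ w ∷ []) (FinP.toℕ-injective (cong proj₁ back))
                                                          (FinP.toℕ-injective (cong proj₂ back))
      where
      x′ = proj₁ (coords x y)
      y′ = proj₂ (coords x y)
      back : (toℕ (proj₁ (coords x′ y′)) , toℕ (proj₂ (coords x′ y′))) ≡ (toℕ x , toℕ y)
      back = begin
        (toℕ (proj₁ (coords x′ y′)) , toℕ (proj₂ (coords x′ y′))) ≡⟨ toℕ-coords x′ y′ ⟩
        match (toℕ x′) (toℕ y′)                                  ≡⟨ cong (λ p → match (proj₁ p) (proj₂ p)) (toℕ-coords x y) ⟩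
        match (proj₁ (match (toℕ x) (toℕ y))) (proj₂ (match (toℕ x) (toℕ y)))
                                                                  ≡⟨ involutive (FinP.toℕ<n x) (FinP.toℕ<n y) ⟩
        (toℕ x , toℕ y)                                          ∎
        where open ≡-Reasoning

  toDimer : Dimer 2 n
  toDimer = record { partner = grid-partner ; adj = grid-adj ; invol = grid-invol }

  x-coord-toDimer : ∀ x y → x-coord (partner toDimer (x ∷ y ∷ [])) ≡ + proj₁ (match (toℕ x) (toℕ y))
  x-coord-toDimer x y = cong (+_ ∘ proj₁) (toℕ-coords x y)

Adj-++ : ∀ {n k d} {u u′ : Vertex k n} (zs : Vertex d n) → Adj u u′ → Adj (u ++ zs) (u′ ++ zs)
Adj-++ zs (here s)     = here s
Adj-++ zs (there u~u′) = there (Adj-++ zs u~u′)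

x-coord-++ : ∀ {n k d} (u : Vertex (suc k) n) (zs : Vertex d n) → x-coord (u ++ zs) ≡ x-coord u
x-coord-++ (_ ∷ _) zs = refl

module _ {d n : ℕ} (Q : Vertex d n → Dimer 2 n) where

  private
    stacked-partner : Vertex (suc (suc d)) n → Vertex (suc (suc d)) n
    stacked-partner (x ∷ y ∷ zs) = partner (Q zs) (x ∷ y ∷ []) ++ zs

    stacked-invol : ∀ v → stacked-partner (stacked-partner v) ≡ v
    stacked-invol (x ∷ y ∷ zs) with partner (Q zs) (x ∷ y ∷ []) | invol (Q zs) (x ∷ y ∷ [])
    ... | _ ∷ _ ∷ [] | back = cong (_++ zs) back

  stack : Dimer (suc (suc d)) n
  stack = record
    { partner = stacked-partner
    ; adj     = λ { (x ∷ y ∷ zs) → Adj-++ zs (adj (Q zs) (x ∷ y ∷ [])) }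
    ; invol   = stacked-invol
    }

  x-coord-stack : ∀ x y zs → x-coord (partner stack (x ∷ y ∷ zs)) ≡ x-coord (partner (Q zs) (x ∷ y ∷ []))
  x-coord-stack x y zs = x-coord-++ (partner (Q zs) (x ∷ y ∷ [])) zs

-- Concentric ring tilings

-- Pairs up the side {p, …, n ∸ 1 ∸ p} of ring p of an n × n grid, n even, as (p , p + 1), (p + 2 , p + 3), …
sidePartner : ℕ → ℕ → ℕ
sidePartner p z = if odd (z + p) then z ∸ 1 else suc z

corner-value : ∀ b X → b ≤ X → sign (odd X) *ᶻ (+ X -ᶻ + sidePartner b X) ≡ - sign (odd b)
corner-value .zero zero    z≤n = refl
corner-value b     (suc X) _   with odd X | odd b | odd (X + b) | odd-+ X b
... | false | false | false | _ = e (+ X)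
  where
  e : ∀ x → - + 1 *ᶻ (+ 1 +ᶻ x -ᶻ x) ≡ - + 1
  e = ℤ-solve
... | false | true  | true  | _ = e (+ X)
  where
  e : ∀ x → - + 1 *ᶻ (+ 1 +ᶻ x -ᶻ (+ 2 +ᶻ x)) ≡ - (- + 1)
  e = ℤ-solve
... | true  | false | true  | _ = e (+ X)
  where
  e : ∀ x → + 1 *ᶻ (+ 1 +ᶻ x -ᶻ (+ 2 +ᶻ x)) ≡ - + 1
  e = ℤ-solve
... | true  | true  | false | _ = e (+ X)
  where
  e : ∀ x → + 1 *ᶻ (+ 1 +ᶻ x -ᶻ x) ≡ - (- + 1)
  e = ℤ-solve
... | false | false | true  | ()
... | false | true  | false | ()
... | true  | false | false | ()
... | true  | true  | true  | ()

edge-value : ∀ b X → b < X → sign (odd X) *ᶻ (+ sidePartner (suc b) X -ᶻ + sidePartner b X) ≡ - (+ 2) *ᶻ sign (odd b)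
edge-value b (suc X) _ rewrite ℕP.+-suc X b with odd X | odd b | odd (X + b) | odd-+ X b
... | false | false | false | _ = e (+ X)
  where
  e : ∀ x → - + 1 *ᶻ (+ 2 +ᶻ x -ᶻ x) ≡ - (+ 2) *ᶻ + 1
  e = ℤ-solve
... | false | true  | true  | _ = e (+ X)
  where
  e : ∀ x → - + 1 *ᶻ (x -ᶻ (+ 2 +ᶻ x)) ≡ - (+ 2) *ᶻ - + 1
  e = ℤ-solve
... | true  | false | true  | _ = e (+ X)
  where
  e : ∀ x → + 1 *ᶻ (x -ᶻ (+ 2 +ᶻ x)) ≡ - (+ 2) *ᶻ + 1
  e = ℤ-solve
... | true  | true  | false | _ = e (+ X)
  where
  e : ∀ x → + 1 *ᶻ (+ 2 +ᶻ x -ᶻ x) ≡ - (+ 2) *ᶻ - + 1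
  e = ℤ-solve
... | false | false | true  | ()
... | false | true  | false | ()
... | true  | false | false | ()
... | true  | true  | true  | ()

-- The i-th ring from the centre contributes (4 i + 2)(2 i + 1) to the difference of the potentials.
ring-sum : ℕ → ℕ
ring-sum h = ∑ⁿ h (λ i → (4 * i + 2) * (2 * i + 1))

ring-sum-cubic : ∀ h → 3 * ring-sum h + (h + h) ≡ (h + h) * (h + h) * (h + h)
ring-sum-cubic zero    = refl
ring-sum-cubic (suc h) = begin
  3 * ring-sum (suc h) + (suc h + suc h)
    ≡⟨ cong (λ T → 3 * T + (suc h + suc h)) (∑ⁿ-snoc h (λ i → (4 * i + 2) * (2 * i + 1))) ⟩
  3 * (ring-sum h + (4 * h + 2) * (2 * h + 1)) + (suc h + suc h)
    ≡⟨ regroup (ring-sum h) h ⟩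
  3 * ring-sum h + (h + h) + (24 * (h * h) + 24 * h + 8)
    ≡⟨ cong (_+ (24 * (h * h) + 24 * h + 8)) (ring-sum-cubic h) ⟩
  (h + h) * (h + h) * (h + h) + (24 * (h * h) + 24 * h + 8)
    ≡⟨ expand h ⟩
  (suc h + suc h) * (suc h + suc h) * (suc h + suc h)
    ∎
  where
  open ≡-Reasoning
  regroup : ∀ T h → 3 * (T + (4 * h + 2) * (2 * h + 1)) + (suc h + suc h) ≡ 3 * T + (h + h) + (24 * (h * h) + 24 * h + 8)
  regroup = ℕ-solve
  expand : ∀ h → (h + h) * (h + h) * (h + h) + (24 * (h * h) + 24 * h + 8) ≡ (suc h + suc h) * (suc h + suc h) * (suc h + suc h)
  expand = ℕ-solve

ring-sum-closed : ∀ h → (h + h) * ((h + h) * (h + h) ∸ 1) ≡ 3 * ring-sum h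
ring-sum-closed h = begin
  n * (n * n ∸ 1)                    ≡⟨ ℕP.*-distribˡ-∸ n (n * n) 1 ⟩
  n * (n * n) ∸ n * 1                ≡⟨ cong₂ _∸_ (trans (sym (ℕP.*-assoc n n n)) (sym (ring-sum-cubic h))) (ℕP.*-identityʳ n) ⟩
  3 * ring-sum h + n ∸ n             ≡⟨ ℕP.m+n∸n≡m (3 * ring-sum h) n ⟩
  3 * ring-sum h                     ∎
  where
  open ≡-Reasoning
  n : ℕ
  n = h + h

module Rings (h : ℕ) where

  n : ℕ
  n = h + h

  depth : ℕ → ℕ
  depth z = z ⊓ (n ∸ suc z)

  OnSide : ℕ → ℕ → Set
  OnSide p z = p ≤ z × suc (z + p) ≤ n

  OnSide⇒<n : ∀ {p z} → OnSide p z → z < n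
  OnSide⇒<n {p} {z} (_ , z+p<n) = ℕP.≤-trans (s≤s (ℕP.m≤m+n z p)) z+p<n

  OnSide⇒depth : ∀ {p z} → OnSide p z → p ≤ depth z
  OnSide⇒depth {p} {z} (p≤z , z+p<n) =
    ℕP.⊓-glb p≤z (ℕP.m+n≤o⇒m≤o∸n p (subst (_≤ n) (ℕP.+-comm (suc z) p) z+p<n))

  depth⇒OnSide : ∀ {p z} → z < n → p ≤ depth z → OnSide p z
  depth⇒OnSide {p} {z} z<n p≤depth =
    ℕP.≤-trans p≤depth (ℕP.m⊓n≤m z _) ,
    subst (_≤ n) (ℕP.+-comm p (suc z)) (ℕP.m≤o∸n⇒m+n≤o p z<n (ℕP.≤-trans p≤depth (ℕP.m⊓n≤n z _)))

  record SideMatch (p z z′ : ℕ) : Set where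
    field
      stays : OnSide p z′
      back  : sidePartner p z′ ≡ z
      step  : Stepℕ z z′

  sideMatch : ∀ p z → OnSide p z → SideMatch p z (sidePartner p z)
  sideMatch p z (p≤z , z+p<n) with odd (z + p) in parity
  ... | false = record { stays = ℕP.m≤n⇒m≤1+n p≤z , z+p+1<n ; back = back ; step = inj₁ refl }
    where
    z+p+1<n : suc (suc z + p) ≤ n
    z+p+1<n = ℕP.≤∧≢⇒< z+p<n (λ z+p+1≡n → true≢false (trans (cong not (sym parity)) (trans (cong odd z+p+1≡n) (odd-double h))))
    back : sidePartner p (suc z) ≡ z
    back rewrite parity = refl
  sideMatch p zero (p≤0 , _) | true with ℕP.n≤0⇒n≡0 p≤0
  ... | refl with () ← parity
  sideMatch p (suc z) (p≤z , z+p<n) | true =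
    record { stays = p≤z-1 , ℕP.≤-trans (ℕP.n≤1+n _) z+p<n ; back = back ; step = inj₂ refl }
    where
    p≤z-1 : p ≤ z
    p≤z-1 = ℕP.≤-pred (ℕP.≤∧≢⇒< p≤z (λ { refl → true≢false (sym (trans (sym (odd-double p)) parity)) }))
    back : sidePartner p z ≡ suc z
    back with odd (z + p) in parity′
    ... | false = refl
    ... | true  = ⊥-elim (true≢false (sym parity))

  -- Ring p = min (depth x) (depth y): its horizontal sides, corners included, are matched along rows,
  -- its vertical sides without the corners (the side of ring p + 1) along columns.
  ringH : ℕ → ℕ → ℕ × ℕ
  ringH x y with depth y ≤? depth x
  ... | yes _ = sidePartner (depth y) x , y
  ... | no _  = x , sidePartner (suc (depth x)) y

  ringH-horizontal : ∀ x y → depth y ≤ depth x → ringH x y ≡ (sidePartner (depth y) x , y)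
  ringH-horizontal x y dy≤dx with depth y ≤? depth x
  ... | yes _     = refl
  ... | no  dy≰dx = ⊥-elim (dy≰dx dy≤dx)

  ringH-vertical : ∀ x y → depth x < depth y → ringH x y ≡ (x , sidePartner (suc (depth x)) y)
  ringH-vertical x y dx<dy with depth y ≤? depth x
  ... | yes dy≤dx = ⊥-elim (ℕP.<⇒≱ dx<dy dy≤dx)
  ... | no  _     = refl

  ringsH : GridMatching n
  ringsH = record { match = ringH ; bounded = bounded ; unit-step = unit-step ; involutive = involutive }
    where
    open SideMatch
    bounded : ∀ {x y} → x < n → y < n → proj₁ (ringH x y) < n × proj₂ (ringH x y) < n
    bounded {x} {y} x<n y<n with depth y ≤? depth x
    ... | yes dy≤dx = OnSide⇒<n (stays (sideMatch _ x (depth⇒OnSide x<n dy≤dx))) , y<n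
    ... | no  dy≰dx = x<n , OnSide⇒<n (stays (sideMatch _ y (depth⇒OnSide y<n (ℕP.≰⇒> dy≰dx))))
    unit-step : ∀ {x y} → x < n → y < n →
                (proj₂ (ringH x y) ≡ y × Stepℕ x (proj₁ (ringH x y))) ⊎
                (proj₁ (ringH x y) ≡ x × Stepℕ y (proj₂ (ringH x y)))
    unit-step {x} {y} x<n y<n with depth y ≤? depth x
    ... | yes dy≤dx = inj₁ (refl , step (sideMatch _ x (depth⇒OnSide x<n dy≤dx)))
    ... | no  dy≰dx = inj₂ (refl , step (sideMatch _ y (depth⇒OnSide y<n (ℕP.≰⇒> dy≰dx))))
    involutive : ∀ {x y} → x < n → y < n → ringH (proj₁ (ringH x y)) (proj₂ (ringH x y)) ≡ (x , y)
    involutive {x} {y} x<n y<n with depth y ≤? depth x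
    ... | yes dy≤dx = let m = sideMatch _ x (depth⇒OnSide x<n dy≤dx) in
      trans (ringH-horizontal _ y (OnSide⇒depth (stays m))) (cong (_, y) (back m))
    ... | no  dy≰dx = let m = sideMatch _ y (depth⇒OnSide y<n (ℕP.≰⇒> dy≰dx)) in
      trans (ringH-vertical x _ (OnSide⇒depth (stays m))) (cong (x ,_) (back m))

  ringsV : GridMatching n
  ringsV = transpose ringsH

  -- proj₂ (ringH Y X) is the x-coordinate of the partner of (X , Y) in the transposed tiling ringsV.
  x-shift : ℕ → ℕ → ℤ
  x-shift X Y = sign (odd X) *ᶻ (+ proj₂ (ringH Y X) -ᶻ + proj₁ (ringH X Y))

  x-shift-shallower : ∀ {X Y b} → depth Y ≡ b → depth X < b → x-shift X Y ≡ + 0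
  x-shift-shallower {X} {Y} refl dX<dY
    rewrite ringH-vertical X Y dX<dY | ringH-horizontal Y X (ℕP.<⇒≤ dX<dY) =
    trans (cong (sign (odd X) *ᶻ_) (ℤP.+-inverseʳ (+ X))) (ℤP.*-zeroʳ (sign (odd X)))

  x-shift-same : ∀ {X Y b} → depth Y ≡ b → depth X ≡ b → x-shift X Y ≡ - sign (odd b)
  x-shift-same {X} {Y} refl dX≡dY
    rewrite ringH-horizontal X Y (ℕP.≤-reflexive (sym dX≡dY)) | ringH-horizontal Y X (ℕP.≤-reflexive dX≡dY) =
    corner-value (depth Y) X (subst (_≤ X) dX≡dY (ℕP.m⊓n≤m X _))

  x-shift-deeper : ∀ {X Y b} → depth Y ≡ b → b < depth X → x-shift X Y ≡ - (+ 2) *ᶻ sign (odd b)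
  x-shift-deeper {X} {Y} refl dY<dX
    rewrite ringH-horizontal X Y (ℕP.<⇒≤ dY<dX) | ringH-vertical Y X dY<dX =
    edge-value (depth Y) X (ℕP.<-≤-trans dY<dX (ℕP.m⊓n≤m X _))

  depth-below : ∀ {p X} → X < n → ¬ OnSide p X → depth X < p
  depth-below X<n ¬side = ℕP.≰⇒> (λ p≤depth → ¬side (depth⇒OnSide X<n p≤depth))

  depth-exact : ∀ {p X} → OnSide p X → ¬ OnSide (suc p) X → depth X ≡ p
  depth-exact side ¬side′ = ℕP.≤-antisym (ℕP.≮⇒≥ (λ p<depth → ¬side′ (depth⇒OnSide (OnSide⇒<n side) p<depth)))
                                         (OnSide⇒depth side)

  row : ℕ → ℤ
  row Y = ∑ᶻ n (λ X → x-shift X Y)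

  module Row {Y b e : ℕ} (depthY : depth Y ≡ b) (h≡ : h ≡ suc (b + e)) where

    n≡ : n ≡ b + suc (e + e + suc b)
    n≡ = trans (cong₂ _+_ h≡ h≡) (shape b e)
      where
      shape : ∀ b e → suc (b + e) + suc (b + e) ≡ b + suc (e + e + suc b)
      shape = ℕ-solve

    left : ∀ X → X < b → x-shift X Y ≡ + 0
    left X X<b = x-shift-shallower depthY (ℕP.≤-<-trans (ℕP.m⊓n≤m X _) X<b)

    left-corner : x-shift (b + 0) Y ≡ - sign (odd b)
    left-corner = x-shift-same depthY (depth-exact side (λ (b<b , _) → ℕP.<-irrefl (sym (ℕP.+-identityʳ b)) b<b))
      where
      side : OnSide b (b + 0)
      side = ℕP.m≤m+n b 0 , subst (suc (b + 0 + b) ≤_) (trans (shape b e) (sym n≡)) (ℕP.m≤m+n _ (suc (e + e)))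
        where
        shape : ∀ b e → suc (b + 0 + b) + suc (e + e) ≡ b + suc (e + e + suc b)
        shape = ℕ-solve

    interior : ∀ j → j < e + e → x-shift (b + suc j) Y ≡ - (+ 2) *ᶻ sign (odd b)
    interior j j<2e = x-shift-deeper depthY (OnSide⇒depth (subst (suc b ≤_) (sym (ℕP.+-suc b j)) (s≤s (ℕP.m≤m+n b j)) , inside))
      where
      inside : suc (b + suc j + suc b) ≤ n
      inside = begin
        suc (b + suc j + suc b)        ≡⟨ shape₁ b j ⟩
        suc j + suc (b + suc b)        ≤⟨ ℕP.+-monoˡ-≤ (suc (b + suc b)) j<2e ⟩
        e + e + suc (b + suc b)        ≡⟨ trans (shape₂ b e) (sym n≡) ⟩
        n                              ∎
        where
        open ℕP.≤-Reasoning
        shape₁ : ∀ b j → suc (b + suc j + suc b) ≡ suc j + suc (b + suc b)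
        shape₁ = ℕ-solve
        shape₂ : ∀ b e → e + e + suc (b + suc b) ≡ b + suc (e + e + suc b)
        shape₂ = ℕ-solve

    right-corner : x-shift (b + suc (e + e + 0)) Y ≡ - sign (odd b)
    right-corner = x-shift-same depthY (depth-exact (ℕP.m≤m+n b _ , ℕP.≤-reflexive fills) too-wide)
      where
      fills : suc (b + suc (e + e + 0) + b) ≡ n
      fills = trans (shape b e) (sym n≡)
        where
        shape : ∀ b e → suc (b + suc (e + e + 0) + b) ≡ b + suc (e + e + suc b)
        shape = ℕ-solve
      too-wide : ¬ OnSide (suc b) (b + suc (e + e + 0))
      too-wide (_ , overflow) = ℕP.<-irrefl refl (subst (_≤ n) (trans (cong suc (ℕP.+-suc _ b)) (cong suc fills)) overflow)

    right : ∀ j → j < b → x-shift (b + suc (e + e + suc j)) Y ≡ + 0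
    right j j<b = x-shift-shallower depthY (depth-below X<n too-wide)
      where
      X<n : b + suc (e + e + suc j) < n
      X<n = subst (b + suc (e + e + suc j) <_) (sym n≡) (ℕP.+-monoʳ-< b (s≤s (ℕP.+-monoʳ-< (e + e) (s≤s j<b))))
      too-wide : ¬ OnSide b (b + suc (e + e + suc j))
      too-wide (_ , overflow) = ℕP.m+1+n≰m n (subst (_≤ n) (trans (shape b e j) (cong (_+ suc j) (sym n≡))) overflow)
        where
        shape : ∀ b e j → suc (b + suc (e + e + suc j) + b) ≡ b + suc (e + e + suc b) + suc j
        shape = ℕ-solve

    -- Along a row of depth b the only nonzero terms are the 2 + 2 e points of ring b itself.
    value : row Y ≡ - ((+ 4 *ᶻ + e +ᶻ + 2) *ᶻ sign (odd b))
    value = begin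
      ∑ᶻ n (λ X → x-shift X Y)
        ≡⟨ cong (λ m → ∑ᶻ m (λ X → x-shift X Y)) n≡ ⟩
      ∑ᶻ (b + suc (e + e + suc b)) (λ X → x-shift X Y)
        ≡⟨ ∑ᶻ-split b _ (λ X → x-shift X Y) ⟩
      ∑ᶻ b (λ X → x-shift X Y) +ᶻ (x-shift (b + 0) Y +ᶻ ∑ᶻ (e + e + suc b) (λ j → x-shift (b + suc j) Y))
        ≡⟨ cong (λ s → ∑ᶻ b (λ X → x-shift X Y) +ᶻ (x-shift (b + 0) Y +ᶻ s)) (∑ᶻ-split (e + e) (suc b) (λ j → x-shift (b + suc j) Y)) ⟩
      ∑ᶻ b (λ X → x-shift X Y) +ᶻ (x-shift (b + 0) Y +ᶻ (∑ᶻ (e + e) (λ j → x-shift (b + suc j) Y) +ᶻ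
        (x-shift (b + suc (e + e + 0)) Y +ᶻ ∑ᶻ b (λ j → x-shift (b + suc (e + e + suc j)) Y))))
        ≡⟨ cong₂ _+ᶻ_ (trans (∑ᶻ-cong b left) (∑ᶻ-zero b))
             (cong₂ _+ᶻ_ left-corner
               (cong₂ _+ᶻ_ (trans (∑ᶻ-cong (e + e) interior) (∑ᶻ-const (e + e) _))
                 (cong₂ _+ᶻ_ right-corner (trans (∑ᶻ-cong b right) (∑ᶻ-zero b))))) ⟩
      + 0 +ᶻ (- sign (odd b) +ᶻ (+ (e + e) *ᶻ (- (+ 2) *ᶻ sign (odd b)) +ᶻ (- sign (odd b) +ᶻ + 0)))
        ≡⟨ collect (+ e) (sign (odd b)) ⟩
      - ((+ 4 *ᶻ + e +ᶻ + 2) *ᶻ sign (odd b))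
        ∎
      where
      open ≡-Reasoning
      collect : ∀ e s → + 0 +ᶻ (- s +ᶻ ((e +ᶻ e) *ᶻ (- (+ 2) *ᶻ s) +ᶻ (- s +ᶻ + 0))) ≡ - ((+ 4 *ᶻ e +ᶻ + 2) *ᶻ s)
      collect = ℤ-solve

  weighted-row : ℕ → ℤ
  weighted-row Y = sign (odd Y) *ᶻ + Y *ᶻ row Y

  -- Rows Y and n ∸ 1 ∸ Y are the two horizontal sides of one ring and have opposite colours,
  -- so their weights combine to the distance 2 i + 1 between them.
  weighted-row-pair : ∀ i Y → h ≡ suc (Y + i) → weighted-row Y +ᶻ weighted-row (h + i) ≡ + ((4 * i + 2) * (2 * i + 1))
  weighted-row-pair i Y h≡ = begin
    sY *ᶻ + Y *ᶻ row Y +ᶻ sH *ᶻ + (h + i) *ᶻ row (h + i)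
      ≡⟨ cong₂ (λ u v → sY *ᶻ + Y *ᶻ u +ᶻ sH *ᶻ + (h + i) *ᶻ v) (Row.value depth-Y h≡) (Row.value depth-h+i h≡) ⟩
    sY *ᶻ + Y *ᶻ - (k *ᶻ sY) +ᶻ sH *ᶻ + (h + i) *ᶻ - (k *ᶻ sY)
      ≡⟨ cong₂ (λ u v → u *ᶻ + Y *ᶻ - (k *ᶻ u) +ᶻ sH *ᶻ v *ᶻ - (k *ᶻ u)) sY≡-sH (cong (λ m → + (m + i)) h≡) ⟩
    - sH *ᶻ + Y *ᶻ - (k *ᶻ - sH) +ᶻ sH *ᶻ (+ 1 +ᶻ + Y +ᶻ + i +ᶻ + i) *ᶻ - (k *ᶻ - sH)
      ≡⟨ collect k sH (+ Y) (+ i) ⟩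
    k *ᶻ (+ 2 *ᶻ + i +ᶻ + 1) *ᶻ (sH *ᶻ sH)
      ≡⟨ cong (k *ᶻ (+ 2 *ᶻ + i +ᶻ + 1) *ᶻ_) (sign-squared (odd (h + i))) ⟩
    k *ᶻ (+ 2 *ᶻ + i +ᶻ + 1) *ᶻ + 1
      ≡⟨ ℤP.*-identityʳ _ ⟩
    k *ᶻ (+ 2 *ᶻ + i +ᶻ + 1)
      ≡⟨ cong₂ _*ᶻ_ (linear 4 i 2) (linear 2 i 1) ⟨
    + (4 * i + 2) *ᶻ + (2 * i + 1)
      ≡⟨ ℤP.pos-* (4 * i + 2) (2 * i + 1) ⟨
    + ((4 * i + 2) * (2 * i + 1))
      ∎
    where
    open ≡-Reasoning
    sY sH k : ℤ
    sY = sign (odd Y)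
    sH = sign (odd (h + i))
    k  = + 4 *ᶻ + i +ᶻ + 2
    collect : ∀ k s y i → - s *ᶻ y *ᶻ - (k *ᶻ - s) +ᶻ s *ᶻ (+ 1 +ᶻ y +ᶻ i +ᶻ i) *ᶻ - (k *ᶻ - s)
                          ≡ k *ᶻ (+ 2 *ᶻ i +ᶻ + 1) *ᶻ (s *ᶻ s)
    collect = ℤ-solve
    linear : ∀ a x c → + (a * x + c) ≡ + a *ᶻ + x +ᶻ + c
    linear a x c = trans (ℤP.pos-+ (a * x) c) (cong (_+ᶻ + c) (ℤP.pos-* a x))

    n≡ : suc (h + i + Y) ≡ n
    n≡ = trans (shape h Y i) (cong (_+_ h) (sym h≡))
      where
      shape : ∀ h Y i → suc (h + i + Y) ≡ h + suc (Y + i)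
      shape = ℕ-solve
    Y≤h+i : Y ≤ h + i
    Y≤h+i = ℕP.≤-trans (ℕP.≤-trans (ℕP.m≤m+n Y i) (ℕP.≤-trans (ℕP.n≤1+n _) (ℕP.≤-reflexive (sym h≡)))) (ℕP.m≤m+n h i)
    depth-Y : depth Y ≡ Y
    depth-Y = depth-exact (ℕP.≤-refl , ℕP.≤-trans (s≤s (ℕP.+-monoˡ-≤ Y Y≤h+i)) (ℕP.≤-reflexive n≡))
                          (λ (Y<Y , _) → ℕP.<-irrefl refl Y<Y)
    depth-h+i : depth (h + i) ≡ Y
    depth-h+i = depth-exact (Y≤h+i , ℕP.≤-reflexive n≡)
                            (λ (_ , overflow) → ℕP.<-irrefl refl (subst (_≤ n) (trans (cong suc (ℕP.+-suc (h + i) Y)) (cong suc n≡)) overflow))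
    sY≡-sH : sY ≡ - sH
    sY≡-sH = sign-opposite (odd Y) (odd (h + i)) (begin
      odd Y xor odd (h + i)      ≡⟨ odd-+ Y (h + i) ⟨
      odd (Y + (h + i))          ≡⟨ cong odd (ℕP.+-comm Y (h + i)) ⟩
      odd (h + i + Y)            ≡⟨ BoolP.not-involutive _ ⟨
      not (odd (suc (h + i + Y))) ≡⟨ cong (not ∘ odd) n≡ ⟩
      not (odd n)                ≡⟨ cong not (odd-double h) ⟩
      true                       ∎)

  total-weight : ∑ᶻ n weighted-row ≡ + ring-sum h
  total-weight = begin
    ∑ᶻ (h + h) weighted-row
      ≡⟨ ∑ᶻ-split h h weighted-row ⟩
    ∑ᶻ h weighted-row +ᶻ ∑ᶻ h (λ i → weighted-row (h + i))
      ≡⟨ cong (_+ᶻ ∑ᶻ h (λ i → weighted-row (h + i))) (∑ᶻ-reverse h weighted-row) ⟩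
    ∑ᶻ h (λ i → weighted-row (h ∸ suc i)) +ᶻ ∑ᶻ h (λ i → weighted-row (h + i))
      ≡⟨ ∑ᶻ-distrib-+ h (λ i → weighted-row (h ∸ suc i)) (λ i → weighted-row (h + i)) ⟨
    ∑ᶻ h (λ i → weighted-row (h ∸ suc i) +ᶻ weighted-row (h + i))
      ≡⟨ ∑ᶻ-cong h (λ i i<h → weighted-row-pair i (h ∸ suc i) (mirror i<h)) ⟩
    ∑ᶻ h (λ i → + ((4 * i + 2) * (2 * i + 1)))
      ≡⟨ ∑ᶻ-pos h (λ i → (4 * i + 2) * (2 * i + 1)) ⟩
    + ring-sum h
      ∎
    where
    open ≡-Reasoning
    mirror : ∀ {i} → i < h → h ≡ suc (h ∸ suc i + i)
    mirror {i} i<h = trans (sym (ℕP.m+[n∸m]≡n i<h)) (cong suc (ℕP.+-comm i (h ∸ suc i)))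

module StackedRings (h d : ℕ) where
  open Rings h

  -- The tiling used in a slice alternates with the colour of the remaining coordinates,
  -- so that their factor in σ cancels and all n ^ d slices contribute alike.
  slice-M slice-N : Vertex d n → Dimer 2 n
  slice-M zs = if colour zs then toDimer ringsV else toDimer ringsH
  slice-N zs = if colour zs then toDimer ringsH else toDimer ringsV

  M N : Dimer (suc (suc d)) n
  M = stack slice-M
  N = stack slice-N

  flux-change : ∀ x y zs →
    flux (x ∷ y ∷ zs) (partner N (x ∷ y ∷ zs)) -ᶻ flux (x ∷ y ∷ zs) (partner M (x ∷ y ∷ zs))
      ≡ sign (odd (toℕ y)) *ᶻ + toℕ y *ᶻ x-shift (toℕ x) (toℕ y)
  flux-change x y zs
    rewrite x-coord-stack slice-N x y zs | x-coord-stack slice-M x y zs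
          | sign-xor (odd (toℕ x)) (odd (toℕ y) xor colour zs) | sign-xor (odd (toℕ y)) (colour zs)
    with colour zs
  ... | false rewrite x-coord-toDimer ringsV x y | x-coord-toDimer ringsH x y =
    identity (sign (odd (toℕ x))) (sign (odd (toℕ y))) (+ toℕ y) (+ toℕ x) (+ proj₂ (ringH (toℕ y) (toℕ x))) (+ proj₁ (ringH (toℕ x) (toℕ y)))
    where
    identity : ∀ sx sy Y X v w → sx *ᶻ (sy *ᶻ + 1) *ᶻ (Y *ᶻ (v -ᶻ X)) -ᶻ sx *ᶻ (sy *ᶻ + 1) *ᶻ (Y *ᶻ (w -ᶻ X))
                                 ≡ sy *ᶻ Y *ᶻ (sx *ᶻ (v -ᶻ w))
    identity = ℤ-solve
  ... | true rewrite x-coord-toDimer ringsH x y | x-coord-toDimer ringsV x y =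
    identity (sign (odd (toℕ x))) (sign (odd (toℕ y))) (+ toℕ y) (+ toℕ x) (+ proj₂ (ringH (toℕ y) (toℕ x))) (+ proj₁ (ringH (toℕ x) (toℕ y)))
    where
    identity : ∀ sx sy Y X v w → sx *ᶻ (sy *ᶻ - + 1) *ᶻ (Y *ᶻ (w -ᶻ X)) -ᶻ sx *ᶻ (sy *ᶻ - + 1) *ᶻ (Y *ᶻ (v -ᶻ X))
                                 ≡ sy *ᶻ Y *ᶻ (sx *ᶻ (v -ᶻ w))
    identity = ℤ-solve

  Φ-gap : Φ N -ᶻ Φ M ≡ + (n ^ d) *ᶻ + ring-sum h
  Φ-gap = begin
    Φ N -ᶻ Φ M
      ≡⟨ Φ-difference M N ⟩
    ℤ∑.sum (λ x → ℤ∑.sum (λ y → ∑ᵛ d (λ zs → Δ (x ∷ y ∷ zs))))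
      ≡⟨ ℤ∑.sum-cong-≗ {n} (λ x → ℤ∑.sum-cong-≗ {n} (λ y → trans (∑ᵛ-cong d (flux-change x y)) (∑ᵛ-const d _))) ⟩
    ∑ᶻ n (λ X → ∑ᶻ n (λ Y → + (n ^ d) *ᶻ G X Y))
      ≡⟨ ℤ∑.∑-comm {n} {n} (λ x y → + (n ^ d) *ᶻ G (toℕ x) (toℕ y)) ⟩
    ∑ᶻ n (λ Y → ∑ᶻ n (λ X → + (n ^ d) *ᶻ G X Y))
      ≡⟨ ∑ᶻ-cong n (λ Y _ → ℤ∑.*-distribˡ-sum {n} (+ (n ^ d)) (λ x → G (toℕ x) Y)) ⟨
    ∑ᶻ n (λ Y → + (n ^ d) *ᶻ ∑ᶻ n (λ X → G X Y))
      ≡⟨ ℤ∑.*-distribˡ-sum {n} (+ (n ^ d)) (λ y → ∑ᶻ n (λ X → G X (toℕ y))) ⟨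
    + (n ^ d) *ᶻ ∑ᶻ n (λ Y → ∑ᶻ n (λ X → G X Y))
      ≡⟨ cong (+ (n ^ d) *ᶻ_) (∑ᶻ-cong n (λ Y _ → ℤ∑.*-distribˡ-sum {n} (sign (odd Y) *ᶻ + Y) (λ x → x-shift (toℕ x) Y))) ⟨
    + (n ^ d) *ᶻ ∑ᶻ n weighted-row
      ≡⟨ cong (+ (n ^ d) *ᶻ_) total-weight ⟩
    + (n ^ d) *ᶻ + ring-sum h
      ∎
    where
    open ≡-Reasoning
    Δ : Vertex (suc (suc d)) n → ℤ
    Δ v = flux v (partner N v) -ᶻ flux v (partner M v)
    G : ℕ → ℕ → ℤ
    G X Y = sign (odd Y) *ᶻ + Y *ᶻ x-shift X Y

  ∣Φ-gap∣ : ∣ Φ N -ᶻ Φ M ∣ ≡ n ^ d * ring-sum h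
  ∣Φ-gap∣ = trans (cong ∣_∣ Φ-gap) (cong ∣_∣ (sym (ℤP.pos-* (n ^ d) (ring-sum h))))

theorem1p7 : (d ℓ n : ℕ) → 2 ≤ d → 2 ≤ ℓ → 2 ≤ n → Even n →
    ∃₂ λ (M N : Dimer d n) → ∀ (t : ℕ) → Walk ℓ t M N →
      n ^ (d ∸ 1) * (n * n ∸ 1) ≤ 6 * (ℓ * ℓ) * t
theorem1p7 (suc zero)    _ _        (s≤s ()) _ _ _
theorem1p7 (suc (suc d)) ℓ .(h + h) _        _ _ (h , refl) = M , N , bound
  where
  open Rings h using (n)
  open StackedRings h d
  bound : ∀ t → Walk ℓ t M N → n ^ suc d * (n * n ∸ 1) ≤ 6 * (ℓ * ℓ) * t
  bound t walk = begin
    n ^ suc d * (n * n ∸ 1)           ≡⟨ regroup n (n ^ d) (n * n ∸ 1) ⟩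
    n ^ d * (n * (n * n ∸ 1))         ≡⟨ cong (_*_ (n ^ d)) (ring-sum-closed h) ⟩
    n ^ d * (3 * ring-sum h)          ≡⟨ swap-factor (n ^ d) 3 (ring-sum h) ⟩
    3 * (n ^ d * ring-sum h)          ≡⟨ cong (_*_ 3) ∣Φ-gap∣ ⟨
    3 * ∣ Φ N -ᶻ Φ M ∣                ≤⟨ ℕP.*-monoʳ-≤ 3 (walk-bound t M N walk) ⟩
    3 * (t * (2 * (ℓ * ℓ)))           ≡⟨ rescale t (ℓ * ℓ) ⟩
    6 * (ℓ * ℓ) * t                   ∎
    where
    open ℕP.≤-Reasoning
    regroup : ∀ a b c → a * b * c ≡ b * (a * c)
    regroup = ℕ-solve
    swap-factor : ∀ a b c → a * (b * c) ≡ b * (a * c)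
    swap-factor = ℕ-solve
    rescale : ∀ t l → 3 * (t * (2 * l)) ≡ 6 * l * t
    rescale = ℕ-solve
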